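{- Let $T\subseteq X_0$ be a generalised nice set with $\langle P_{\{1,2,1\}}\rangle\subseteq T$. Then: (i) If $|T\cap X_E|=2$, then $|T\cap X|\in\{2,4,6,10\}$; more precisely: if $|T\cap X|=2$ then $T\cap X=\{\{1,2\},\{1,5\}\}$; if $|T\cap X|=4$ then $T\cap X=\{\{1,2\},\{1,k\},\{1,5\},\{1,k*1\}\}$ for some $k\in\{3,4,6,7\}$; if $|T\cap X|=6$ then $T\cap X=X_{(1)}=\{\{1,l\}:l=2,\dots,7\}$; if $|T\cap X|=10$ then $T\cap X$ equals $T_{(1,j,k)}$ or $T_{(1,j*k,k)}$ for some $j\in\{2,5\}$ and $k\in\{3,4,6,7\}$. (ii) If $|T\cap X_E|>2$, then $|T\cap X|\in\{3,15,21\}$; more precisely: if $|T\cap X|=3$ then $T\cap X=X_{\ell_{12}}$; if $|T\cap X|=15$ then there is $s\in I\setminus\{1\}$ with $T\cap X=X\setminus X_{\ell_{1s}^C}$; if $|T\cap X|=21$ then $T\cap X=X$.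
   Context: Let $I=\{1,\dots,7\}$ and $I_0=I\cup\{0\}$. The Fano plane on $I$ has the seven lines $\{1,2,5\},\{5,6,7\},\{1,4,7\},\{1,3,6\},\{2,4,6\},\{2,3,7\},\{3,4,5\}$. For distinct $i,j\in I$, $i*j$ is the third point of the unique line containing $i$ and $j$, and $\ell_{ij}=\{i,j,i*j\}$. The operation is extended to $I_0$ by $0*i=i*0=i$ and $i*i=0$ for all $i\in I_0$. Three pairwise distinct $i,j,k\in I$ are generative if $k\neq i*j$. Let $X_0$ be the set of unordered pairs $\{i,j\}$ with $i,j\in I_0$, where $i=j$ is allowed; $X=\{\{i,j\}:i,j\in I,\ i\neq j\}$, $X_E=\{\{i,i\}:i\in I_0\}$. For a line $\ell$, $X_\ell=\{\{i,j\}\in X:i,j\in\ell\}$ and $X_{\ell^C}=\{\{i,j\}\in X:i,j\notin\ell\}$; for $i\in I$, $X_{(i)}=\{\{i,j\}\in X: j\neq i\}$. For $i,j,k\in I_0$ let $P_{\{i,j,k\}}=\{\{i,j\},\{j,k\},\{k,i\},\{i,j*k\},\{j,k*i\},\{k,i*j\}\}\subseteq X_0$. For generative $i,j,k\in I$, $T_{(i,j,k)}=P_{\{i,j,k\}}\cup\{\{i,i*j\},\{i,i*k\},\{i*j,i*k\},\{i,i*j*k\}\}$. A subset $T\subseteq X_0$ is a generalised nice set if for all $i,j,k\in I_0$, $\{i,j\}\in T$ and $\{i*j,k\}\in T$ imply $P_{\{i,j,k\}}\subseteq T$. For $S\subseteq X_0$, $\langle S\rangle$ denotes the smallest generalised nice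 set containing $S$. -}

module Defs where

open import Data.Bool using (Bool; true; false; _∧_; _∨_; not; if_then_else_)
open import Data.Nat using (ℕ; zero; suc; _≤?_)
open import Data.Fin using (Fin; #_; toℕ)
open import Data.Fin.Properties using (_≟_)
open import Data.List using (List; []; _∷_; filter; length; concatMap; map)
open import Data.List using (allFin) public
open import Data.Product using (_×_; _,_)
open import Relation.Nullary.Decidable using (⌊_⌋)
open import Relation.Binary.PropositionalEquality using (_≡_)

-- I₀ = {0,…,7} is Fin 8; I = {1,…,7} are the nonzero elements.
Pt : Set
Pt = Fin 8

infix 4 _==_
_==_ : Pt → Pt → Bool
i == j = ⌊ i ≟ j ⌋

fanoLines : List (Pt × Pt × Pt)
fanoLines =
  (# 1 , # 2 , # 5) ∷ (# 5 , # 6 , # 7) ∷ (# 1 , # 4 , # 7) ∷ (# 1 , # 3 , # 6) ∷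
  (# 2 , # 4 , # 6) ∷ (# 2 , # 3 , # 7) ∷ (# 3 , # 4 , # 5) ∷ []

onLine : Pt → Pt × Pt × Pt → Bool
onLine p (a , b , c) = (p == a) ∨ (p == b) ∨ (p == c)

anyL : {A : Set} → (A → Bool) → List A → Bool
anyL f [] = false
anyL f (x ∷ xs) = f x ∨ anyL f xs

collinear : Pt → Pt → Pt → Bool
collinear i j k = anyL (λ l → onLine i l ∧ onLine j l ∧ onLine k l) fanoLines

isZero : Pt → Bool
isZero i = i == # 0

findL : (Pt → Bool) → List Pt → Pt
findL f [] = # 0
findL f (x ∷ xs) = if f x then x else findL f xs

third : Pt → Pt → Pt
third i j = findL (λ k → not (isZero k) ∧ not (k == i) ∧ not (k == j) ∧ collinear i j k)
                  (allFin 8)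

infixl 7 _*_
infixr 6 _∪_ _∩_ _∖_
infix 4 _≐_ _⊆_
_*_ : Pt → Pt → Pt
i * j = if i == j then # 0
        else if isZero i then j
        else if isZero j then i
        else third i j

generative : Pt → Pt → Pt → Bool
generative i j k = not (isZero i) ∧ not (isZero j) ∧ not (isZero k)
                 ∧ not (i == j) ∧ not (j == k) ∧ not (i == k) ∧ not (k == i * j)

-- Subsets of X₀ (unordered pairs {i,j}, i = j allowed) are represented as
-- symmetric Bool-valued relations on I₀:  {i,j} ∈ T  iff  T i j ≡ true.

PairSet : Set
PairSet = Pt → Pt → Bool

Symmetric : PairSet → Set
Symmetric T = ∀ i j → T i j ≡ T j i

_⊆_ : PairSet → PairSet → Set
A ⊆ B = ∀ i j → A i j ≡ true → B i j ≡ true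

_≐_ : PairSet → PairSet → Set
A ≐ B = ∀ i j → A i j ≡ B i j

pair : Pt → Pt → PairSet
pair x y a b = ((a == x) ∧ (b == y)) ∨ ((a == y) ∧ (b == x))

_∪_ : PairSet → PairSet → PairSet
(A ∪ B) a b = A a b ∨ B a b

_∩_ : PairSet → PairSet → PairSet
(A ∩ B) a b = A a b ∧ B a b

_∖_ : PairSet → PairSet → PairSet
(A ∖ B) a b = A a b ∧ not (B a b)

X : PairSet
X i j = not (isZero i) ∧ not (isZero j) ∧ not (i == j)

XE : PairSet
XE i j = i == j

inℓ : Pt → Pt → Pt → Bool
inℓ i j p = (p == i) ∨ (p == j) ∨ (p == i * j)

Xℓ : Pt → Pt → PairSet
Xℓ i j a b = X a b ∧ inℓ i j a ∧ inℓ i j b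

XℓC : Pt → Pt → PairSet
XℓC i j a b = X a b ∧ not (inℓ i j a) ∧ not (inℓ i j b)

X⟨_⟩ : Pt → PairSet
X⟨ i ⟩ a b = X a b ∧ ((a == i) ∨ (b == i))

P : Pt → Pt → Pt → PairSet
P i j k = pair i j ∪ pair j k ∪ pair k i ∪ pair i (j * k) ∪ pair j (k * i) ∪ pair k (i * j)

Tg : Pt → Pt → Pt → PairSet
Tg i j k = P i j k ∪ pair i (i * j) ∪ pair i (i * k) ∪ pair (i * j) (i * k) ∪ pair i (i * j * k)

Nice : PairSet → Set
Nice T = ∀ i j k → T i j ≡ true → T (i * j) k ≡ true → P i j k ⊆ T

Closure : PairSet → Pt → Pt → Set
Closure S a b = ∀ (U : PairSet) → Symmetric U → Nice U → S ⊆ U → U a b ≡ true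

ClosureSub : PairSet → PairSet → Set
ClosureSub S T = ∀ a b → Closure S a b → T a b ≡ true

countL : {A : Set} → (A → Bool) → List A → ℕ
countL f [] = 0
countL f (x ∷ xs) = if f x then suc (countL f xs) else countL f xs

-- unordered pairs {a,b} ∈ X₀ enumerated once each as (a,b) with a ≤ b
allPairs : List (Pt × Pt)
allPairs = concatMap (λ a → map (λ b → (a , b)) (filter (λ b → toℕ a ≤? toℕ b) (allFin 8))) (allFin 8)

card : PairSet → ℕ
card A = countL (λ { (a , b) → A a b }) allPairs

{-# OPTIONS --safe #-}
module Submission where

-- A symmetric set T ⊆ X₀ is determined by which of the 36 unordered pairs it
-- contains, so the theorem is a finite statement; it is proved by a verified
-- branch-and-bound search. Walking through the pairs, a branch either puts the
-- next pair into T, and then adds everything the niceness rule forces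
-- ({i,j}, {i*j,k} ∈ T ⇒ P_{ijk} ⊆ T), or records it as absent; a branch dies as
-- soon as a forced pair was recorded absent. Every symmetric nice T containing
-- P_{1,2,1} follows one branch to a leaf, where T is exactly the set of pairs
-- put in. Evaluation shows that the twelve surviving leaves satisfy the
-- classification.

open import Defs
open import Data.Bool using (Bool; true; false; _∧_; _∨_; not; if_then_else_)
import Data.Bool.Properties as Bool
open import Data.Nat using (ℕ; suc; _>_)
import Data.Nat.Properties as ℕ
open import Data.Fin using (#_)
open import Data.Fin.Properties using (_≟_; all?; any?)
open import Data.Vec using (Vec; []; _∷_; lookup; tabulate)
open import Data.Vec.Properties using (lookup∘tabulate)
open import Data.List using (List; []; _∷_; _++_; foldl; concatMap; map)
import Data.List.Relation.Unary.All as All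
open import Data.List.Relation.Unary.All using (All; _∷_)
open import Data.List.Relation.Unary.Any using (Any; here; there)
open import Data.List.Relation.Unary.Any.Properties using (++⁺ˡ; ++⁺ʳ)
open import Data.Product using (Σ; ∃₂; _×_; _,_; map₂)
open import Data.Sum using (_⊎_; inj₁; inj₂)
import Data.Sum as Sum
open import Data.Empty using (⊥; ⊥-elim)
open import Function using (_∘_)
open import Relation.Nullary using (Dec; yes; no; ¬?)
open import Relation.Nullary.Decidable using (from-yes; _×-dec_; _⊎-dec_; _→-dec_)
open import Relation.Binary.PropositionalEquality using (_≡_; refl; sym; trans; cong; subst; subst₂)

-- The operation * as a table: computing it by searching the Fano lines is far
-- too slow to evaluate inside the search.
mulTable : Vec (Vec Pt 8) 8
mulTable =
  (# 0 ∷ # 1 ∷ # 2 ∷ # 3 ∷ # 4 ∷ # 5 ∷ # 6 ∷ # 7 ∷ []) ∷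
  (# 1 ∷ # 0 ∷ # 5 ∷ # 6 ∷ # 7 ∷ # 2 ∷ # 3 ∷ # 4 ∷ []) ∷
  (# 2 ∷ # 5 ∷ # 0 ∷ # 7 ∷ # 6 ∷ # 1 ∷ # 4 ∷ # 3 ∷ []) ∷
  (# 3 ∷ # 6 ∷ # 7 ∷ # 0 ∷ # 5 ∷ # 4 ∷ # 1 ∷ # 2 ∷ []) ∷
  (# 4 ∷ # 7 ∷ # 6 ∷ # 5 ∷ # 0 ∷ # 3 ∷ # 2 ∷ # 1 ∷ []) ∷
  (# 5 ∷ # 2 ∷ # 1 ∷ # 4 ∷ # 3 ∷ # 0 ∷ # 7 ∷ # 6 ∷ []) ∷
  (# 6 ∷ # 3 ∷ # 4 ∷ # 1 ∷ # 2 ∷ # 7 ∷ # 0 ∷ # 5 ∷ []) ∷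
  (# 7 ∷ # 4 ∷ # 3 ∷ # 2 ∷ # 1 ∷ # 6 ∷ # 5 ∷ # 0 ∷ []) ∷ []

infixl 7 _·_
_·_ : Pt → Pt → Pt
i · j = lookup (lookup mulTable i) j

·≡* : ∀ i j → i · j ≡ i * j
·≡* = from-yes (all? λ i → all? λ j → i · j ≟ i * j)

P-with : (Pt → Pt → Pt) → Pt → Pt → Pt → PairSet
P-with _⋆_ i j k = pair i j ∪ pair j k ∪ pair k i ∪ pair i (j ⋆ k) ∪ pair j (k ⋆ i) ∪ pair k (i ⋆ j)

P-with-cong : ∀ {f g} → (∀ i j → f i j ≡ g i j) → ∀ i j k → P-with f i j k ≐ P-with g i j k
P-with-cong f≗g i j k a b rewrite f≗g j k | f≗g k i | f≗g i j = refl

P·≐P : ∀ i j k → P-with _·_ i j k ≐ P i j k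
P·≐P = P-with-cong ·≡*

∁ : PairSet → PairSet
∁ A a b = not (A a b)

≐-sym : ∀ {A B} → A ≐ B → B ≐ A
≐-sym A≐B a b = sym (A≐B a b)

≐-trans : ∀ {A B C} → A ≐ B → B ≐ C → A ≐ C
≐-trans A≐B B≐C a b = trans (A≐B a b) (B≐C a b)

≐⇒⊆ : ∀ {A B} → A ≐ B → A ⊆ B
≐⇒⊆ A≐B a b A∋ab = trans (sym (A≐B a b)) A∋ab

⊆-trans : ∀ {A B C} → A ⊆ B → B ⊆ C → A ⊆ C
⊆-trans A⊆B B⊆C a b = B⊆C a b ∘ A⊆B a b

∪-least : ∀ {A B C} → A ⊆ C → B ⊆ C → A ∪ B ⊆ C
∪-least {A} A⊆C B⊆C a b A∪B∋ab with A a b in A∋ab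
... | true  = A⊆C a b A∋ab
... | false = B⊆C a b A∪B∋ab

∩-congˡ : ∀ {A B} C → A ≐ B → (A ∩ C) ≐ (B ∩ C)
∩-congˡ C A≐B a b = cong (_∧ C a b) (A≐B a b)

∁-symmetric : ∀ {A} → Symmetric A → Symmetric (∁ A)
∁-symmetric sym-A a b = cong not (sym-A a b)

pair-sound : ∀ {a b x y} → pair a b x y ≡ true → (x ≡ a × y ≡ b) ⊎ (x ≡ b × y ≡ a)
pair-sound {a} {b} {x} {y} h with x ≟ a | y ≟ b | x ≟ b | y ≟ a
... | yes x≡a | yes y≡b | _       | _       = inj₁ (x≡a , y≡b)
... | _       | _       | yes x≡b | yes y≡a = inj₂ (x≡b , y≡a)
pair-sound () | no _  | _    | no _  | _
pair-sound () | no _  | _    | yes _ | no _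
pair-sound () | yes _ | no _ | no _  | _
pair-sound () | yes _ | no _ | yes _ | no _

pair⊆ : ∀ {A a b} → Symmetric A → A a b ≡ true → pair a b ⊆ A
pair⊆ {a = a} {b} sym-A A∋ab x y xy∈ab with pair-sound {a} {b} {x} {y} xy∈ab
... | inj₁ (refl , refl) = A∋ab
... | inj₂ (refl , refl) = trans (sym-A x y) A∋ab

closureSub⇒⊆ : ∀ {S T} → ClosureSub S T → S ⊆ T
closureSub⇒⊆ ⟨S⟩⊆T a b S∋ab = ⟨S⟩⊆T a b (λ U _ _ S⊆U → S⊆U a b S∋ab)

infixr 5 _◂_
_◂_ : ∀ {c d : Bool} {m n : ℕ} → c ≡ d → m ≡ n → (if c then suc m else m) ≡ (if d then suc n else n)
refl ◂ refl = refl

-- One step per element of allPairs: a congruence lemma for countL would be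
-- checked against card by unfolding both sides into 36 nested conditionals and
-- comparing both branches of each, in exponential time.
card-cong : ∀ {A B} → A ≐ B → card A ≡ card B
card-cong e =
  e (# 0) (# 0) ◂ e (# 0) (# 1) ◂ e (# 0) (# 2) ◂ e (# 0) (# 3) ◂ e (# 0) (# 4) ◂ e (# 0) (# 5) ◂ e (# 0) (# 6) ◂ e (# 0) (# 7) ◂
  e (# 1) (# 1) ◂ e (# 1) (# 2) ◂ e (# 1) (# 3) ◂ e (# 1) (# 4) ◂ e (# 1) (# 5) ◂ e (# 1) (# 6) ◂ e (# 1) (# 7) ◂
  e (# 2) (# 2) ◂ e (# 2) (# 3) ◂ e (# 2) (# 4) ◂ e (# 2) (# 5) ◂ e (# 2) (# 6) ◂ e (# 2) (# 7) ◂
  e (# 3) (# 3) ◂ e (# 3) (# 4) ◂ e (# 3) (# 5) ◂ e (# 3) (# 6) ◂ e (# 3) (# 7) ◂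
  e (# 4) (# 4) ◂ e (# 4) (# 5) ◂ e (# 4) (# 6) ◂ e (# 4) (# 7) ◂
  e (# 5) (# 5) ◂ e (# 5) (# 6) ◂ e (# 5) (# 7) ◂
  e (# 6) (# 6) ◂ e (# 6) (# 7) ◂
  e (# 7) (# 7) ◂
  refl

Table : Set
Table = Vec (Vec Bool 8) 8

⟦_⟧ : Table → PairSet
⟦ t ⟧ a b = lookup (lookup t a) b

table : PairSet → Table
table S = tabulate λ a → tabulate λ b → S a b

⟦table⟧ : ∀ S → ⟦ table S ⟧ ≐ S
⟦table⟧ S a b =
  trans (cong (λ row → lookup row b) (lookup∘tabulate (λ a → tabulate (S a)) a)) (lookup∘tabulate (S a) b)

infixr 6 _∪ᵗ_
_∪ᵗ_ : Table → PairSet → Table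
t ∪ᵗ S = table (⟦ t ⟧ ∪ S)

∪ᵗ-least : ∀ {t S A} → ⟦ t ⟧ ⊆ A → S ⊆ A → ⟦ t ∪ᵗ S ⟧ ⊆ A
∪ᵗ-least {t} {S} t⊆A S⊆A = ⊆-trans (≐⇒⊆ (⟦table⟧ (⟦ t ⟧ ∪ S))) (∪-least t⊆A S⊆A)

∅ᵗ : Table
∅ᵗ = table (λ _ _ → false)

∅ᵗ⊆ : ∀ A → ⟦ ∅ᵗ ⟧ ⊆ A
∅ᵗ⊆ A = ⊆-trans {⟦ ∅ᵗ ⟧} {λ _ _ → false} (≐⇒⊆ (⟦table⟧ (λ _ _ → false))) (λ _ _ ())

if-⊆ : ∀ {b t t′ A} → (b ≡ true → ⟦ t′ ⟧ ⊆ A) → ⟦ t ⟧ ⊆ A → ⟦ if b then t′ else t ⟧ ⊆ A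
if-⊆ {true}  t′⊆A _   = t′⊆A refl
if-⊆ {false} _    t⊆A = t⊆A

Triple : Set
Triple = Pt × Pt × Pt

triples : List Triple
triples = concatMap (λ i → concatMap (λ j → map (λ k → i , j , k) (allFin 8)) (allFin 8)) (allFin 8)

P-present : Table → Triple → Bool
P-present t (i , j , k) =
  ⟦ t ⟧ i j ∧ ⟦ t ⟧ j k ∧ ⟦ t ⟧ k i ∧ ⟦ t ⟧ i (j · k) ∧ ⟦ t ⟧ j (k · i) ∧ ⟦ t ⟧ k (i · j)

-- The P-present test only spares rebuilding the table when nothing is new.
nice-step : Table → Triple → Table
nice-step t (i , j , k) =
  if ⟦ t ⟧ i j ∧ ⟦ t ⟧ (i · j) k ∧ not (P-present t (i , j , k)) then t ∪ᵗ P-with _·_ i j k else t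

nice-steps : List Triple → Table → Table
nice-steps τs t = foldl nice-step t τs

module _ {T : PairSet} (nice : Nice T) where

  nice-step-sound : ∀ {t} τ → ⟦ t ⟧ ⊆ T → ⟦ nice-step t τ ⟧ ⊆ T
  nice-step-sound {t} (i , j , k) t⊆T = if-⊆ extend-sound t⊆T
    where
    extend-sound : ⟦ t ⟧ i j ∧ ⟦ t ⟧ (i · j) k ∧ not (P-present t (i , j , k)) ≡ true →
                   ⟦ t ∪ᵗ P-with _·_ i j k ⟧ ⊆ T
    extend-sound premises = ∪ᵗ-least {t} {P-with _·_ i j k} t⊆T P⊆T
      where
      t∋ij,k : ⟦ t ⟧ (i · j) k ≡ true
      t∋ij,k = Bool.∧-conicalˡ _ _ (Bool.∧-conicalʳ (⟦ t ⟧ i j) _ premises)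
      T∋ij,k : T (i * j) k ≡ true
      T∋ij,k = subst (λ m → T m k ≡ true) (·≡* i j) (t⊆T (i · j) k t∋ij,k)
      P⊆T : P-with _·_ i j k ⊆ T
      P⊆T = ⊆-trans {P-with _·_ i j k} (≐⇒⊆ (P·≐P i j k))
              (nice i j k (t⊆T i j (Bool.∧-conicalˡ _ _ premises)) T∋ij,k)

  nice-steps-sound : ∀ τs {t} → ⟦ t ⟧ ⊆ T → ⟦ nice-steps τs t ⟧ ⊆ T
  nice-steps-sound []       t⊆T = t⊆T
  nice-steps-sound (τ ∷ τs) {t} t⊆T = nice-steps-sound τs {nice-step t τ} (nice-step-sound {t} τ t⊆T)

-- A leaf (S , F): the pairs S put into the set and the pairs F recorded absent.
Leaf : Set
Leaf = Table × Table

Agrees : PairSet → Leaf → Set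
Agrees T (S , F) = ⟦ S ⟧ ⊆ T × ⟦ F ⟧ ⊆ ∁ T

clash? : (S F : Table) → Dec (∃₂ λ a b → ⟦ S ⟧ a b ≡ true × ⟦ F ⟧ a b ≡ true)
clash? S F = any? λ a → any? λ b → (⟦ S ⟧ a b Bool.≟ true) ×-dec (⟦ F ⟧ a b Bool.≟ true)

-- propagate is an argument rather than a module parameter because evaluating a
-- module-application copy of search is far slower.
search : (Table → Table) → List (Pt × Pt) → Table → Table → List Leaf
search propagate vs S F with clash? S F
... | yes _ = []
search propagate [] S F | no _ = (S , F) ∷ []
search propagate ((a , b) ∷ vs) S F | no _ with ⟦ S ⟧ a b
... | true  = search propagate vs S F
... | false = search propagate vs (propagate (S ∪ᵗ pair a b)) F ++ search propagate vs S (F ∪ᵗ pair a b)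

module _ {T : PairSet} (sym-T : Symmetric T)
         {propagate : Table → Table} (propagate-sound : ∀ {t} → ⟦ t ⟧ ⊆ T → ⟦ propagate t ⟧ ⊆ T) where

  mutual
    search-sound : ∀ vs S F → Agrees T (S , F) → Any (Agrees T) (search propagate vs S F)
    search-sound vs S F (S⊆T , F⊆∁T) with clash? S F
    ... | yes (a , b , S∋ab , F∋ab) = ⊥-elim (Bool.not-¬ (sym (S⊆T a b S∋ab)) (sym (F⊆∁T a b F∋ab)))
    search-sound [] S F agrees | no _ = here agrees
    search-sound ((a , b) ∷ vs) S F agrees | no _ with ⟦ S ⟧ a b
    ... | true  = search-sound vs S F agrees
    ... | false = branch-sound vs S F a b agrees (T a b) refl

    -- T a b decides which branch T follows. It is matched as a fresh variable
    -- because abstracting it with "with" makes Agda evaluate the search on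
    -- symbolic tables.
    branch-sound : ∀ vs S F a b → Agrees T (S , F) → ∀ v → T a b ≡ v →
      Any (Agrees T) (search propagate vs (propagate (S ∪ᵗ pair a b)) F ++ search propagate vs S (F ∪ᵗ pair a b))
    branch-sound vs S F a b (S⊆T , F⊆∁T) true T∋ab =
      ++⁺ˡ (search-sound vs (propagate (S ∪ᵗ pair a b)) F
        (propagate-sound {S ∪ᵗ pair a b} (∪ᵗ-least {S} {pair a b} S⊆T (pair⊆ sym-T T∋ab)) , F⊆∁T))
    branch-sound vs S F a b (S⊆T , F⊆∁T) false T∌ab =
      ++⁺ʳ (search propagate vs (propagate (S ∪ᵗ pair a b)) F)
        (search-sound vs S (F ∪ᵗ pair a b)
          (S⊆T , ∪ᵗ-least {F} {pair a b} F⊆∁T (pair⊆ (∁-symmetric sym-T) (cong not T∌ab))))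

Decided : Leaf → Set
Decided (S , F) = ∀ a b → ⟦ S ⟧ a b ∨ ⟦ F ⟧ a b ≡ true

decided? : ∀ l → Dec (Decided l)
decided? (S , F) = all? λ a → all? λ b → ⟦ S ⟧ a b ∨ ⟦ F ⟧ a b Bool.≟ true

agrees∧decided⇒≐ : ∀ {T S F} → Agrees T (S , F) → Decided (S , F) → T ≐ ⟦ S ⟧
agrees∧decided⇒≐ {T} {S} {F} (S⊆T , F⊆∁T) decided a b with ⟦ S ⟧ a b in S∌ab
... | true  = S⊆T a b S∌ab
... | false = trans (sym (Bool.not-involutive (T a b))) (cong not (F⊆∁T a b F∋ab))
  where
  F∋ab : ⟦ F ⟧ a b ≡ true
  F∋ab = subst (λ s → s ∨ ⟦ F ⟧ a b ≡ true) S∌ab (decided a b)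

Classified : ℕ → ℕ → PairSet → Set
Classified e x Y =
    (e ≡ 2 →
      (x ≡ 2 ⊎ x ≡ 4 ⊎ x ≡ 6 ⊎ x ≡ 10)
      × (x ≡ 2 → Y ≐ (pair (# 1) (# 2) ∪ pair (# 1) (# 5)))
      × (x ≡ 4 →
          Σ Pt (λ k → (k ≡ # 3 ⊎ k ≡ # 4 ⊎ k ≡ # 6 ⊎ k ≡ # 7)
            × (Y ≐ (pair (# 1) (# 2) ∪ pair (# 1) k ∪ pair (# 1) (# 5) ∪ pair (# 1) (k * # 1)))))
      × (x ≡ 6 → Y ≐ X⟨ # 1 ⟩)
      × (x ≡ 10 →
          Σ Pt (λ j → Σ Pt (λ k → (j ≡ # 2 ⊎ j ≡ # 5) × (k ≡ # 3 ⊎ k ≡ # 4 ⊎ k ≡ # 6 ⊎ k ≡ # 7)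
            × (Y ≐ Tg (# 1) j k ⊎ Y ≐ Tg (# 1) (j * k) k)))))
    × (e > 2 →
      (x ≡ 3 ⊎ x ≡ 15 ⊎ x ≡ 21)
      × (x ≡ 3 → Y ≐ Xℓ (# 1) (# 2))
      × (x ≡ 15 →
          Σ Pt (λ s → (s ≡ # 0 → ⊥) × (s ≡ # 1 → ⊥) × (Y ≐ (X ∖ XℓC (# 1) s))))
      × (x ≡ 21 → Y ≐ X))

Classification : PairSet → Set
Classification T = Classified (card (T ∩ XE)) (card (T ∩ X)) (T ∩ X)

infix 4 _≐?_
_≐?_ : (A B : PairSet) → Dec (A ≐ B)
A ≐? B = all? λ a → all? λ b → A a b Bool.≟ B a b

classified? : ∀ e x Y → Dec (Classified e x Y)
classified? e x Y =
    (e ℕ.≟ 2 →-dec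
      ((x ℕ.≟ 2 ⊎-dec x ℕ.≟ 4 ⊎-dec x ℕ.≟ 6 ⊎-dec x ℕ.≟ 10)
      ×-dec (x ℕ.≟ 2 →-dec Y ≐? pair (# 1) (# 2) ∪ pair (# 1) (# 5))
      ×-dec (x ℕ.≟ 4 →-dec
          any? λ k → (k ≟ # 3 ⊎-dec k ≟ # 4 ⊎-dec k ≟ # 6 ⊎-dec k ≟ # 7)
            ×-dec Y ≐? pair (# 1) (# 2) ∪ pair (# 1) k ∪ pair (# 1) (# 5) ∪ pair (# 1) (k * # 1))
      ×-dec (x ℕ.≟ 6 →-dec Y ≐? X⟨ # 1 ⟩)
      ×-dec (x ℕ.≟ 10 →-dec
          any? λ j → any? λ k → (j ≟ # 2 ⊎-dec j ≟ # 5) ×-dec (k ≟ # 3 ⊎-dec k ≟ # 4 ⊎-dec k ≟ # 6 ⊎-dec k ≟ # 7)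
            ×-dec (Y ≐? Tg (# 1) j k ⊎-dec Y ≐? Tg (# 1) (j * k) k))))
    ×-dec (2 ℕ.<? e →-dec
      ((x ℕ.≟ 3 ⊎-dec x ℕ.≟ 15 ⊎-dec x ℕ.≟ 21)
      ×-dec (x ℕ.≟ 3 →-dec Y ≐? Xℓ (# 1) (# 2))
      ×-dec (x ℕ.≟ 15 →-dec
          any? λ s → ¬? (s ≟ # 0) ×-dec ¬? (s ≟ # 1) ×-dec Y ≐? X ∖ XℓC (# 1) s)
      ×-dec (x ℕ.≟ 21 →-dec Y ≐? X)))

Classified-respʸ : ∀ {e x Y Y′} → Y ≐ Y′ → Classified e x Y → Classified e x Y′
Classified-respʸ {Y = Y} {Y′} Y≐Y′ (small , large) =
  (λ e≡2 → let (sizes , two , four , six , ten) = small e≡2 in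
     sizes , move ∘ two , map₂ (map₂ move) ∘ four , move ∘ six ,
     map₂ (map₂ (map₂ (map₂ (Sum.map move move)))) ∘ ten) ,
  (λ e>2 → let (sizes , three , fifteen , twentyone) = large e>2 in
     sizes , move ∘ three , map₂ (map₂ (map₂ move)) ∘ fifteen , move ∘ twentyone)
  where
  move : ∀ {R} → Y ≐ R → Y′ ≐ R
  move = ≐-trans (≐-sym Y≐Y′)

Classification-resp : ∀ {A B} → A ≐ B → Classification A → Classification B
Classification-resp {A} {B} A≐B =
  subst₂ (λ e x → Classified e x (B ∩ X))
    (card-cong {A ∩ XE} {B ∩ XE} (∩-congˡ XE A≐B)) (card-cong {A ∩ X} {B ∩ X} (∩-congˡ X A≐B))
  ∘ Classified-respʸ {Y = A ∩ X} {B ∩ X} (∩-congˡ X A≐B)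

Good : Leaf → Set
Good (S , F) = Decided (S , F) × Classification ⟦ S ⟧

good? : ∀ l → Dec (Good l)
good? (S , F) = decided? (S , F) ×-dec classified? (card (⟦ S ⟧ ∩ XE)) (card (⟦ S ⟧ ∩ X)) (⟦ S ⟧ ∩ X)

-- Here and elsewhere implicit arguments are given explicitly: left to
-- unification, they would be solved only after unfolding counts or
-- propagations on symbolic tables, which takes exponential time.
good-classifies : ∀ {T S F} → Good (S , F) → Agrees T (S , F) → Classification T
good-classifies {T} {S} {F} (decided , classified) agrees =
  Classification-resp {⟦ S ⟧} {T} (≐-sym {T} {⟦ S ⟧} (agrees∧decided⇒≐ {T} {S} {F} agrees decided)) classified

all-good-classifies : ∀ {T ls} → All Good ls → Any (Agrees T) ls → Classification T
all-good-classifies {T} {(S , F) ∷ _} (good ∷ _) (here agrees)  = good-classifies {T} {S} {F} good agrees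
all-good-classifies                   (_ ∷ goods) (there agrees) = all-good-classifies goods agrees

P₁₂₁ : Table
P₁₂₁ = table (P-with _·_ (# 1) (# 2) (# 1))

-- A single propagation pass happens to reach the closure at every node of this
-- search, which is what keeps the leaves nice; soundness does not depend on it.
leaves-good : All Good (search (nice-steps triples) allPairs (nice-steps triples P₁₂₁) ∅ᵗ)
leaves-good = from-yes (All.all? good? (search (nice-steps triples) allPairs (nice-steps triples P₁₂₁) ∅ᵗ))

theorem5p6 : (T : PairSet) → Symmetric T → Nice T → ClosureSub (P (# 1) (# 2) (# 1)) T →
    (card (T ∩ XE) ≡ 2 →
      (card (T ∩ X) ≡ 2 ⊎ card (T ∩ X) ≡ 4 ⊎ card (T ∩ X) ≡ 6 ⊎ card (T ∩ X) ≡ 10)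
      × (card (T ∩ X) ≡ 2 → (T ∩ X) ≐ (pair (# 1) (# 2) ∪ pair (# 1) (# 5)))
      × (card (T ∩ X) ≡ 4 →
          Σ Pt (λ k → (k ≡ # 3 ⊎ k ≡ # 4 ⊎ k ≡ # 6 ⊎ k ≡ # 7)
            × ((T ∩ X) ≐ (pair (# 1) (# 2) ∪ pair (# 1) k ∪ pair (# 1) (# 5) ∪ pair (# 1) (k * # 1)))))
      × (card (T ∩ X) ≡ 6 → (T ∩ X) ≐ X⟨ # 1 ⟩)
      × (card (T ∩ X) ≡ 10 →
          Σ Pt (λ j → Σ Pt (λ k → (j ≡ # 2 ⊎ j ≡ # 5) × (k ≡ # 3 ⊎ k ≡ # 4 ⊎ k ≡ # 6 ⊎ k ≡ # 7)
            × ((T ∩ X) ≐ Tg (# 1) j k ⊎ (T ∩ X) ≐ Tg (# 1) (j * k) k)))))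
    × (card (T ∩ XE) > 2 →
      (card (T ∩ X) ≡ 3 ⊎ card (T ∩ X) ≡ 15 ⊎ card (T ∩ X) ≡ 21)
      × (card (T ∩ X) ≡ 3 → (T ∩ X) ≐ Xℓ (# 1) (# 2))
      × (card (T ∩ X) ≡ 15 →
          Σ Pt (λ s → (s ≡ # 0 → ⊥) × (s ≡ # 1 → ⊥) × ((T ∩ X) ≐ (X ∖ XℓC (# 1) s))))
      × (card (T ∩ X) ≡ 21 → (T ∩ X) ≐ X))
theorem5p6 T sym-T nice ⟨P₁₂₁⟩⊆T =
  all-good-classifies {T} leaves-good
    (search-sound sym-T {nice-steps triples} (λ {t} → nice-steps-sound nice triples {t})
      allPairs (nice-steps triples P₁₂₁) ∅ᵗ (nice-steps-sound nice triples {P₁₂₁} P₁₂₁⊆T , ∅ᵗ⊆ (∁ T)))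
  where
  P₁₂₁⊆T : ⟦ P₁₂₁ ⟧ ⊆ T
  P₁₂₁⊆T = ⊆-trans {⟦ P₁₂₁ ⟧} {P (# 1) (# 2) (# 1)}
             (≐⇒⊆ (≐-trans (⟦table⟧ (P-with _·_ (# 1) (# 2) (# 1))) (P·≐P (# 1) (# 2) (# 1))))
             (closureSub⇒⊆ ⟨P₁₂₁⟩⊆T)
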